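{- Let $N$ be a positive integer and for each prime $p\le N$ let $S_p=\{(x,px): x\in\mathbb{N},\ px\le N\}$. Consider the algorithm which runs through the primes $p\le N$ in descending order, and for each such $p$ runs through the pairs of $S_p$ in descending order, selecting each pair that shares no endpoint with any previously selected pair. Then the set of selected pairs is a matching in the graph $G_N$ that contains no flat alternating cycle.
   Context: $G_N$ is the graph with vertex set $\{1,\dots,N\}$ and an edge between $x$ and $y$ iff $y/x$ or $x/y$ is a prime number (i.e. one covers the other in the divisibility order). The rank of $n$ is its number of prime factors counted with multiplicity. A matching is a set of edges no two sharing an endpoint. A cycle is alternating (with respect to the matching) if exactly every other edge of the cycle lies in the matching, and flat if all its vertices have rank $n$ or $n+1$ for some $n$. -}

module Defs where

open import Data.Nat using (ℕ; zero; suc; _+_; _*_; _≤_; _<_; _≡ᵇ_)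
open import Data.Nat.DivMod using (_/_)
open import Data.Nat.Primality using (Prime; prime?)
open import Data.Bool using (Bool; true; false; _∨_; if_then_else_)
open import Data.List using (List; []; _∷_; map; filter; downFrom; concatMap)
open import Data.Bool.ListAction using (any)
open import Data.List.Membership.Propositional using (_∈_)
open import Data.Product using (_×_; _,_; proj₁; proj₂; ∃)
open import Data.Sum using (_⊎_)
open import Data.Empty using (⊥)
open import Relation.Binary.PropositionalEquality using (_≡_)

Vertex : ℕ → ℕ → Set
Vertex N x = 1 ≤ x × x ≤ N

Covers : ℕ → ℕ → Set
Covers x y = ∃ λ p → Prime p × y ≡ p * x

Adj : ℕ → ℕ → ℕ → Set
Adj N x y = Vertex N x × Vertex N y × (Covers x y ⊎ Covers y x)

-- Rank Ω(n): number of prime factors counted with multiplicity,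
-- as an (inductively defined) relation  Rank n k  ⇔  Ω(n) = k.

data Rank : ℕ → ℕ → Set where
  rank-one  : Rank 1 0
  rank-step : ∀ {p n k} → Prime p → Rank n k → Rank (p * n) (suc k)

primesDesc : ℕ → List ℕ
primesDesc N = filter prime? (downFrom (suc N))

Sdesc : ℕ → ℕ → List (ℕ × ℕ)
Sdesc N zero    = []
Sdesc N (suc q) = map (λ x → (x , suc q * x)) (map suc (downFrom (N / suc q)))

candidates : ℕ → List (ℕ × ℕ)
candidates N = concatMap (Sdesc N) (primesDesc N)

used : ℕ → List (ℕ × ℕ) → Bool
used v = any (λ e → (v ≡ᵇ proj₁ e) ∨ (v ≡ᵇ proj₂ e))

greedy : List (ℕ × ℕ) → List (ℕ × ℕ) → List (ℕ × ℕ)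
greedy sel []            = sel
greedy sel ((x , y) ∷ cs) =
  if used x sel ∨ used y sel then greedy sel cs else greedy ((x , y) ∷ sel) cs

selected : ℕ → List (ℕ × ℕ)
selected N = greedy [] (candidates N)

InM : List (ℕ × ℕ) → ℕ → ℕ → Set
InM M x y = (x , y) ∈ M ⊎ (y , x) ∈ M

SharesEndpoint : ℕ × ℕ → ℕ × ℕ → Set
SharesEndpoint (a , b) (c , d) = a ≡ c ⊎ a ≡ d ⊎ b ≡ c ⊎ b ≡ d

SameEdge : ℕ × ℕ → ℕ × ℕ → Set
SameEdge (a , b) (c , d) = (a ≡ c × b ≡ d) ⊎ (a ≡ d × b ≡ c)

IsMatching : ℕ → List (ℕ × ℕ) → Set
IsMatching N M =
  (∀ {e} → e ∈ M → Adj N (proj₁ e) (proj₂ e)) ×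
  (∀ {e f} → e ∈ M → f ∈ M → SharesEndpoint e f → SameEdge e f)

IsCycle : ℕ → ℕ → (ℕ → ℕ) → Set
IsCycle N k v =
  3 ≤ k ×
  (∀ i → v (i + k) ≡ v i) ×
  (∀ i j → i < k → j < k → v i ≡ v j → i ≡ j) ×
  (∀ i → Adj N (v i) (v (suc i)))

Alternating : List (ℕ × ℕ) → (ℕ → ℕ) → Set
Alternating M v = ∀ i →
  (InM M (v i) (v (suc i)) ⊎ InM M (v (suc i)) (v (suc (suc i)))) ×
  (InM M (v i) (v (suc i)) × InM M (v (suc i)) (v (suc (suc i))) → ⊥)

Flat : (ℕ → ℕ) → Set
Flat v = ∃ λ n → ∀ i → Rank (v i) n ⊎ Rank (v i) (suc n)

{-# OPTIONS --safe #-}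
module Submission where

-- Every selected pair is an edge (x , p x) of G_N, and the greedy rule never selects
-- two pairs with a common endpoint. Along a flat cycle the ranks alternate between n
-- and n + 1, so the edges alternately go up and down, multiplying or dividing by their
-- prime labels. Let p be the largest label on the cycle. An unselected cycle edge with
-- label q was rejected because of an earlier, hence heavier, selected pair touching
-- it; that pair is the neighbouring matched edge of the cycle, whose label is then at
-- least q, and consecutive labels differ (otherwise the cycle would backtrack), so
-- q < p. Hence the edges labelled p are matched, and as matched edges alternate in
-- step with the direction, they all point the same way, say up. But once around the
-- cycle the product of the upward labels equals the product of the downward ones, and
-- p divides only the former.

open import Defs
open import Data.Bool using (Bool; true; false; not; T; _∨_; if_then_else_)
import Data.Bool.Properties as Bool
open import Data.Empty using (⊥; ⊥-elim)
open import Data.List using (List; []; _∷_; upTo; downFrom)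
import Data.List.Relation.Unary.All as All
import Data.List.Relation.Unary.All.Properties as All
open import Data.List.Relation.Unary.AllPairs using (AllPairs; []; _∷_)
import Data.List.Relation.Unary.AllPairs as AllPairs
import Data.List.Relation.Unary.AllPairs.Properties as AllPairs
open import Data.List.Relation.Unary.Any as Any using (Any; here; there)
open import Data.List.Relation.Unary.Any.Properties using (any⁺; any⁻)
open import Data.List.Membership.Propositional using (_∈_; find; lose)
open import Data.List.Membership.Propositional.Properties
  using ( ∈-upTo⁺; ∈-upTo⁻; ∈-map⁺; ∈-map⁻; ∈-concatMap⁺; ∈-concatMap⁻
        ; ∈-filter⁺; ∈-filter⁻; ∈-downFrom⁺; ∈-downFrom⁻)
open import Data.Nat
  using ( ℕ; zero; suc; pred; _+_; _*_; _≤_; _<_; z<s; s≤s; _<?_; _≟_; _≡ᵇ_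
        ; NonZero; >-nonZero; >-nonZero⁻¹; nonTrivial⇒n>1)
open import Data.Nat.DivMod using (_/_; _%_; m≡m%n+[m/n]*n; m%n<n; m*n/n≡m; m/n*n≤m; /-monoˡ-≤)
open import Data.Nat.Divisibility using (_∣_; _∤_; divides; m∣m*n; ∣m⇒∣m*n; ∣n⇒∣m*n; ∣1⇒≡1; ∣-refl; >⇒∤)
open import Data.Nat.Primality
  using (Prime; prime?; prime⇒nonZero; prime⇒nonTrivial; prime⇒irreducible; euclidsLemma)
open import Data.Nat.Properties
open import Algebra.Properties.CommutativeSemigroup *-commutativeSemigroup using (x∙yz≈y∙xz)
open import Algebra.Properties.CommutativeSemigroup +-commutativeSemigroup
  using () renaming (xy∙z≈xz∙y to +-right-comm)
open import Data.List.Extrema ≤-totalOrder using (argmax; argmax-sel; f[xs]≤f[argmax])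
open import Data.Product using (∃; _×_; _,_; proj₁; proj₂)
open import Data.Sum using (_⊎_; inj₁; inj₂; [_,_]′)
import Data.Sum as Sum
open import Function using (_∘_; id)
open import Function.Bundles using (_⇔_; mk⇔; Equivalence)
open import Relation.Binary.PropositionalEquality
  using (_≡_; _≢_; refl; sym; trans; cong; cong₂; subst; subst₂; module ≡-Reasoning)
open import Relation.Nullary using (¬_; yes; no)

prime⇒>1 : ∀ {p} → Prime p → 1 < p
prime⇒>1 {p} pp = nonTrivial⇒n>1 p {{prime⇒nonTrivial pp}}

prime∣prime⇒≡ : ∀ {p q} → Prime p → Prime q → p ∣ q → p ≡ q
prime∣prime⇒≡ pp pq p∣q with prime⇒irreducible pq p∣q
... | inj₁ refl = ⊥-elim (<-irrefl refl (prime⇒>1 pp))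
... | inj₂ p≡q = p≡q

prime∤1 : ∀ {p} → Prime p → p ∤ 1
prime∤1 pp p∣1 = <-irrefl (sym (∣1⇒≡1 p∣1)) (prime⇒>1 pp)

prime*≢1 : ∀ {p m} → Prime p → p * m ≢ 1
prime*≢1 {p} {m} pp eq = prime∤1 pp (subst (p ∣_) eq (m∣m*n m))

x<q*x : ∀ {x q} → 0 < x → 1 < q → x < q * x
x<q*x {x} {q} 0<x 1<q = subst (x <_) (*-comm x q) (m<m*n x q {{>-nonZero 0<x}} 1<q)

-- Ranks and steps

rank-1 : ∀ {m j} → Rank m j → m ≡ 1 → j ≡ 0
rank-1 rank-one _ = refl
rank-1 (rank-step pp _) eq = ⊥-elim (prime*≢1 pp eq)

rank-divide : ∀ {m j p r} → Rank m j → Prime p → m ≡ p * r → ∃ λ j' → j ≡ suc j' × Rank r j'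
rank-divide rank-one pp eq = ⊥-elim (prime*≢1 pp (sym eq))
rank-divide {p = p} {r} (rank-step {q} {n} {k} pq rn) pp eq with p ≟ q
... | yes refl = k , refl , subst (λ m → Rank m k) (*-cancelˡ-≡ n r p {{prime⇒nonZero pp}} eq) rn
... | no p≢q with euclidsLemma q n pp (divides r (trans eq (*-comm p r)))
...   | inj₁ p∣q = ⊥-elim (p≢q (prime∣prime⇒≡ pp pq p∣q))
...   | inj₂ (divides s n≡s*p) with rank-divide rn pp (trans n≡s*p (*-comm s p))
...     | k' , refl , rs = suc k' , refl , subst (λ m → Rank m (suc k')) (sym r≡q*s) (rank-step pq rs)
  where
  r≡q*s : r ≡ q * s
  r≡q*s = *-cancelˡ-≡ r (q * s) p {{prime⇒nonZero pp}} (begin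
    p * r        ≡⟨ sym eq ⟩
    q * n        ≡⟨ cong (q *_) (trans n≡s*p (*-comm s p)) ⟩
    q * (p * s)  ≡⟨ x∙yz≈y∙xz q p s ⟩
    p * (q * s)  ∎)
    where open ≡-Reasoning

rank-unique : ∀ {m a b} → Rank m a → Rank m b → a ≡ b
rank-unique rank-one r = sym (rank-1 r refl)
rank-unique (rank-step pp rn) r with rank-divide r pp refl
... | _ , refl , r' = cong suc (rank-unique rn r')

rank-cover : ∀ {p x y a b} → Prime p → y ≡ p * x → Rank x a → Rank y b → b ≡ suc a
rank-cover pp refl rx ry = rank-unique ry (rank-step pp rx)

Level : ℕ → ℕ → Set
Level n x = Rank x n ⊎ Rank x (suc n)

lower : ∀ {n x} → Level n x → Bool
lower (inj₁ _) = true
lower (inj₂ _) = false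

cover-levels : ∀ {n p x y} → Prime p → y ≡ p * x → (lx : Level n x) (ly : Level n y) →
  lower lx ≡ true × lower ly ≡ false
cover-levels pp e (inj₁ rx) (inj₂ ry) = refl , refl
cover-levels pp e (inj₁ rx) (inj₁ ry) = ⊥-elim (1+n≢n (sym (rank-cover pp e rx ry)))
cover-levels pp e (inj₂ rx) (inj₁ ry) = ⊥-elim (m≢1+n+m _ (rank-cover pp e rx ry))
cover-levels pp e (inj₂ rx) (inj₂ ry) = ⊥-elim (1+n≢n (sym (rank-cover pp e rx ry)))

Step : Bool → ℕ → ℕ → ℕ → Set
Step true  q x y = y ≡ q * x
Step false q x y = x ≡ q * y

flat-step : ∀ {n x y} (lx : Level n x) (ly : Level n y) → Covers x y ⊎ Covers y x →
  ∃ λ q → Prime q × Step (lower lx) q x y × lower ly ≡ not (lower lx)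
flat-step lx ly (inj₁ (q , pq , e)) with cover-levels pq e lx ly
... | lx≡true , ly≡false = q , pq , subst (λ b → Step b q _ _) (sym lx≡true) e ,
                             trans ly≡false (cong not (sym lx≡true))
flat-step lx ly (inj₂ (q , pq , e)) with cover-levels pq e ly lx
... | ly≡true , lx≡false = q , pq , subst (λ b → Step b q _ _) (sym lx≡false) e ,
                             trans ly≡true (cong not (sym lx≡false))

step-back : ∀ {b q x y z} → .{{NonZero q}} → Step b q x y → Step (not b) q y z → z ≡ x
step-back {true}  {q} {x} {z = z} y≡qx y≡qz = *-cancelˡ-≡ z x q (trans (sym y≡qz) y≡qx)
step-back {false} x≡qy z≡qy = trans z≡qy (sym x≡qy)

step-factor-unique : ∀ {b b' q q' x y} → 0 < x → 1 < q → 1 < q' →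
  Step b q x y → Step b' q' x y → q ≡ q'
step-factor-unique {true} {true} {q} {q'} {x} 0<x _ _ e e' =
  *-cancelʳ-≡ q q' x {{>-nonZero 0<x}} (trans (sym e) e')
step-factor-unique {true} {false} {q} {x = x} 0<x 1<q 1<q' refl x≡q'y =
  ⊥-elim (<-asym x<y (subst (q * x <_) (sym x≡q'y) (x<q*x (<-trans 0<x x<y) 1<q')))
  where
  x<y : x < q * x
  x<y = x<q*x 0<x 1<q
step-factor-unique {false} {true} {q' = q'} {x = x} 0<x 1<q 1<q' x≡qy refl =
  ⊥-elim (<-asym x<y (subst (q' * x <_) (sym x≡qy) (x<q*x (<-trans 0<x x<y) 1<q)))
  where
  x<y : x < q' * x
  x<y = x<q*x 0<x 1<q'
step-factor-unique {false} {false} {q} {q'} {y = y} 0<x _ _ refl e' =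
  *-cancelʳ-≡ q q' y {{m*n≢0⇒n≢0 q {{>-nonZero 0<x}}}} e'

-- Periodic sequences

Periodic : ∀ {A : Set} → ℕ → (ℕ → A) → Set
Periodic k f = ∀ i → f (i + k) ≡ f i

module _ {A : Set} {k : ℕ} {f : ℕ → A} (per : Periodic k f) where

  periodic-+* : ∀ i m → f (i + m * k) ≡ f i
  periodic-+* i zero    = cong f (+-identityʳ i)
  periodic-+* i (suc m) = begin
    f (i + (k + m * k))  ≡⟨ cong f (trans (cong (i +_) (+-comm k (m * k))) (sym (+-assoc i (m * k) k))) ⟩
    f (i + m * k + k)    ≡⟨ per (i + m * k) ⟩
    f (i + m * k)        ≡⟨ periodic-+* i m ⟩
    f i                  ∎
    where open ≡-Reasoning

  periodic-% : .{{_ : NonZero k}} → ∀ i → f i ≡ f (i % k)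
  periodic-% i = trans (cong f (m≡m%n+[m/n]*n i k)) (periodic-+* (i % k) (i / k))

  periodic-distinct : .{{_ : NonZero k}} →
    (∀ i j → i < k → j < k → f i ≡ f j → i ≡ j) →
    ∀ i {d} → 0 < d → d < k → f (i + d) ≢ f i
  periodic-distinct inj i {d} 0<d d<k eq = distinct-from (m%n<n i k) (begin
    f (i % k + d)               ≡⟨ sym (periodic-+* (i % k + d) (i / k)) ⟩
    f (i % k + d + i / k * k)   ≡⟨ cong f (+-right-comm (i % k) d (i / k * k)) ⟩
    f (i % k + i / k * k + d)   ≡⟨ cong (λ m → f (m + d)) (sym (m≡m%n+[m/n]*n i k)) ⟩
    f (i + d)                   ≡⟨ eq ⟩
    f i                         ≡⟨ periodic-% i ⟩
    f (i % k)                   ∎)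
    where
    open ≡-Reasoning
    distinct-from : ∀ {a} → a < k → f (a + d) ≢ f a
    distinct-from {a} a<k e with a + d <? k
    ... | yes a+d<k =
      <-irrefl (sym (+-cancelˡ-≡ a d 0 (trans (inj (a + d) a a+d<k a<k e) (sym (+-identityʳ a))))) 0<d
    ... | no a+d≮k with m≤n⇒∃[o]m+o≡n (≮⇒≥ a+d≮k)
    ...   | c , k+c≡a+d = <-irrefl (sym (+-cancelʳ-≡ a k d k+a≡d+a)) d<k
      where
      c<k : c < k
      c<k = +-cancelˡ-< k c k (subst (_< k + k) (sym k+c≡a+d) (+-mono-< a<k d<k))
      c≡a : c ≡ a
      c≡a = inj c a c<k a<k (trans (sym (per c)) (trans (cong f (trans (+-comm c k) k+c≡a+d)) e))
      k+a≡d+a : k + a ≡ d + a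
      k+a≡d+a = trans (cong (k +_) (sym c≡a)) (trans k+c≡a+d (+-comm a d))

periodic-max : ∀ {k} {f : ℕ → ℕ} → .{{_ : NonZero k}} → Periodic k f →
  ∃ λ j → j < k × ∀ i → f i ≤ f j
periodic-max {k} {f} per = j , j<k , bound
  where
  j : ℕ
  j = argmax f 0 (upTo k)
  j<k : j < k
  j<k = [_,_]′ (λ j≡0 → subst (_< k) (sym j≡0) (>-nonZero⁻¹ k)) ∈-upTo⁻ (argmax-sel f 0 (upTo k))
  bound : ∀ i → f i ≤ f j
  bound i = subst (_≤ f j) (sym (periodic-% per i))
    (All.lookup (f[xs]≤f[argmax] {f = f} 0 (upTo k)) (∈-upTo⁺ (m%n<n i k)))

Alternates : (ℕ → Set) → Set
Alternates P = ∀ i → (P i ⊎ P (suc i)) × ¬ (P i × P (suc i))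

alternates-next : ∀ {P Q} → Alternates P → Alternates Q → ∀ {i} → (Q i → P i) → P (suc i) → Q (suc i)
alternates-next altP altQ {i} Q⇒P Psi =
  [ (λ Qi → ⊥-elim (proj₂ (altP i) (Q⇒P Qi , Psi))) , id ]′ (proj₁ (altQ i))

alternates-prev : ∀ {P Q} → Alternates P → Alternates Q → ∀ {i} → (Q (suc i) → P (suc i)) → P i → Q i
alternates-prev altP altQ {i} Q⇒P Pi =
  [ id , (λ Qsi → ⊥-elim (proj₂ (altP i) (Pi , Q⇒P Qsi))) ]′ (proj₁ (altQ i))

alternates-agree : ∀ {P Q} → Alternates P → Alternates Q → ∀ j → (P j ⇔ Q j) → ∀ i → P i ⇔ Q i
alternates-agree {P} {Q} altP altQ j P⇔Q = upward (downward j P⇔Q)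
  where
  open Equivalence
  downward : ∀ j → (P j ⇔ Q j) → P 0 ⇔ Q 0
  downward zero    h = h
  downward (suc j) h =
    downward j (mk⇔ (alternates-prev altP altQ (from h)) (alternates-prev altQ altP (to h)))
  upward : (P 0 ⇔ Q 0) → ∀ i → P i ⇔ Q i
  upward h zero    = h
  upward h (suc i) =
    mk⇔ (alternates-next altP altQ (from (upward h i))) (alternates-next altQ altP (to (upward h i)))

alternates-bool : ∀ {u : ℕ → Bool} → (∀ i → u (suc i) ≡ not (u i)) → ∀ b → Alternates (λ i → u i ≡ b)
alternates-bool {u} flips b i = covered , excluded
  where
  covered : u i ≡ b ⊎ u (suc i) ≡ b
  covered with u i Bool.≟ b
  ... | yes ui≡b = inj₁ ui≡b
  ... | no  ui≢b = inj₂ (trans (flips i) (sym (Bool.¬-not (ui≢b ∘ sym))))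
  excluded : ¬ (u i ≡ b × u (suc i) ≡ b)
  excluded (ui≡b , usi≡b) = Bool.not-¬ refl (sym (trans (sym (flips i)) (trans usi≡b (sym ui≡b))))

-- Closed walks

productWhere : (ℕ → Bool) → (ℕ → ℕ) → ℕ → ℕ
productWhere P f zero    = 1
productWhere P f (suc i) = (if P i then f i else 1) * productWhere P f i

∣-productWhere : ∀ {P f p t i} → t < i → P t ≡ true → p ∣ f t → p ∣ productWhere P f i
∣-productWhere {P} {f} {t = t} {suc i} t<1+i Pt p∣ft with m≤n⇒m<n∨m≡n (≤-pred t<1+i)
... | inj₁ t<i  = ∣n⇒∣m*n (if P i then f i else 1) (∣-productWhere {P} {f} t<i Pt p∣ft)
... | inj₂ refl rewrite Pt = ∣m⇒∣m*n _ p∣ft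

prime∤* : ∀ {p m n} → Prime p → p ∤ m → p ∤ n → p ∤ m * n
prime∤* {m = m} pp p∤m p∤n = [ p∤m , p∤n ]′ ∘ euclidsLemma m _ pp

∤-productWhere : ∀ {P f p} i → Prime p → (∀ t → t < i → P t ≡ true → p ∤ f t) → p ∤ productWhere P f i
∤-productWhere zero    pp _ = prime∤1 pp
∤-productWhere {P} {f} {p} (suc i) pp coprime =
  prime∤* pp factor (∤-productWhere i pp (λ t t<i → coprime t (m<n⇒m<1+n t<i)))
  where
  factor : p ∤ (if P i then f i else 1)
  factor with P i in Pi
  ... | true  = coprime i ≤-refl Pi
  ... | false = prime∤1 pp

balance-step : ∀ b {q x y x₀ D U} → Step b q x y → x * D ≡ x₀ * U →
  y * ((if not b then q else 1) * D) ≡ x₀ * ((if b then q else 1) * U)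
balance-step true {q} {x} {y} {x₀} {D} {U} y≡qx balanced = begin
  y * (1 * D)      ≡⟨ cong₂ _*_ y≡qx (*-identityˡ D) ⟩
  q * x * D        ≡⟨ *-assoc q x D ⟩
  q * (x * D)      ≡⟨ cong (q *_) balanced ⟩
  q * (x₀ * U)     ≡⟨ x∙yz≈y∙xz q x₀ U ⟩
  x₀ * (q * U)     ∎
  where open ≡-Reasoning
balance-step false {q} {x} {y} {x₀} {D} {U} x≡qy balanced = begin
  y * (q * D)      ≡⟨ x∙yz≈y∙xz y q D ⟩
  q * (y * D)      ≡⟨ *-assoc q y D ⟨
  q * y * D        ≡⟨ cong (_* D) x≡qy ⟨
  x * D            ≡⟨ balanced ⟩
  x₀ * U           ≡⟨ cong (x₀ *_) (*-identityˡ U) ⟨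
  x₀ * (1 * U)     ∎
  where open ≡-Reasoning

walk-balance : ∀ {v : ℕ → ℕ} {u r} → (∀ i → Step (u i) (r i) (v i) (v (suc i))) →
  ∀ i → v i * productWhere (not ∘ u) r i ≡ v 0 * productWhere u r i
walk-balance step zero    = refl
walk-balance {v} step (suc i) = balance-step _ {x₀ = v 0} (step i) (walk-balance step i)

closed-walk-balanced : ∀ {v : ℕ → ℕ} {u r p k t} → Prime p →
  (∀ i → Step (u i) (r i) (v i) (v (suc i))) → 0 < v 0 → v k ≡ v 0 →
  t < k → p ∣ r t → ¬ (∀ s → s < k → u s ≢ u t → p ∤ r s)
closed-walk-balanced {v} {u} {r} {p} {k} {t} pp step 0<v₀ closed t<k p∣rt one-way =
  by-direction (u t) refl
  where
  products-equal : productWhere (not ∘ u) r k ≡ productWhere u r k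
  products-equal = *-cancelˡ-≡ _ _ (v 0) {{>-nonZero 0<v₀}}
    (trans (cong (_* productWhere (not ∘ u) r k) (sym closed)) (walk-balance step k))
  opposite : ∀ {s} → not (u s) ≡ u t → u s ≢ u t
  opposite e e' = Bool.not-¬ (sym e') (sym e)
  by-direction : ∀ b → u t ≡ b → ⊥
  by-direction true ut =
    ∤-productWhere k pp (λ s s<k nus → one-way s s<k (opposite (trans nus (sym ut))))
      (subst (p ∣_) (sym products-equal) (∣-productWhere {u} t<k ut p∣rt))
  by-direction false ut =
    ∤-productWhere k pp (λ s s<k us → one-way s s<k (opposite (trans (cong not us) (sym ut))))
      (subst (p ∣_) products-equal (∣-productWhere {not ∘ u} t<k (cong not ut) p∣rt))

-- The greedy selection

Endpoint : ℕ → ℕ × ℕ → Set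
Endpoint z e = z ≡ proj₁ e ⊎ z ≡ proj₂ e

Touches : ℕ × ℕ → ℕ × ℕ → Set
Touches e f = ∃ λ z → Endpoint z e × Endpoint z f

shared-endpoint : ∀ {e f} → SharesEndpoint e f → Touches e f
shared-endpoint {_ , _} {_ , _} (inj₁ a≡c)               = _ , inj₁ refl , inj₁ a≡c
shared-endpoint {_ , _} {_ , _} (inj₂ (inj₁ a≡d))        = _ , inj₁ refl , inj₂ a≡d
shared-endpoint {_ , _} {_ , _} (inj₂ (inj₂ (inj₁ b≡c))) = _ , inj₂ refl , inj₁ b≡c
shared-endpoint {_ , _} {_ , _} (inj₂ (inj₂ (inj₂ b≡d))) = _ , inj₂ refl , inj₂ b≡d

endpoints-shared : ∀ {z e f} → Endpoint z e → Endpoint z f → SharesEndpoint e f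
endpoints-shared {e = _ , _} {_ , _} (inj₁ refl) (inj₁ z≡c) = inj₁ z≡c
endpoints-shared {e = _ , _} {_ , _} (inj₁ refl) (inj₂ z≡d) = inj₂ (inj₁ z≡d)
endpoints-shared {e = _ , _} {_ , _} (inj₂ refl) (inj₁ z≡c) = inj₂ (inj₂ (inj₁ z≡c))
endpoints-shared {e = _ , _} {_ , _} (inj₂ refl) (inj₂ z≡d) = inj₂ (inj₂ (inj₂ z≡d))

used⇔ : ∀ {z} sel → T (used z sel) ⇔ Any (Endpoint z) sel
used⇔ {z} sel = mk⇔ (Any.map endpoint ∘ any⁻ _ sel) (any⁺ _ ∘ Any.map endpoint⁻¹)
  where
  open Equivalence
  endpoint : ∀ {e} → T ((z ≡ᵇ proj₁ e) ∨ (z ≡ᵇ proj₂ e)) → Endpoint z e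
  endpoint = Sum.map (≡ᵇ⇒≡ _ _) (≡ᵇ⇒≡ _ _) ∘ to Bool.T-∨
  endpoint⁻¹ : ∀ {e} → Endpoint z e → T ((z ≡ᵇ proj₁ e) ∨ (z ≡ᵇ proj₂ e))
  endpoint⁻¹ = from Bool.T-∨ ∘ Sum.map (≡⇒≡ᵇ _ _) (≡⇒≡ᵇ _ _)

used-true : ∀ {z sel} → used z sel ≡ true → ∃ λ e → e ∈ sel × Endpoint z e
used-true {sel = sel} eq = find (Equivalence.to (used⇔ sel) (Equivalence.from Bool.T-≡ eq))

used-false : ∀ {z sel e} → used z sel ≡ false → e ∈ sel → ¬ Endpoint z e
used-false {sel = sel} eq e∈ z∈e = subst T eq (Equivalence.from (used⇔ sel) (lose e∈ z∈e))

pair-used : ∀ {x y sel} → used x sel ∨ used y sel ≡ true →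
  ∃ λ f → f ∈ sel × Touches (x , y) f
pair-used {x} {y} {sel} eq with used x sel in ux
... | true  = let f , f∈ , x∈f = used-true ux in f , f∈ , x , inj₁ refl , x∈f
... | false = let f , f∈ , y∈f = used-true eq in f , f∈ , y , inj₂ refl , y∈f

pair-unused : ∀ {x y sel z e} → used x sel ∨ used y sel ≡ false →
  e ∈ sel → Endpoint z (x , y) → ¬ Endpoint z e
pair-unused {x} {y} {sel} eq e∈ z∈xy with used x sel in ux | used y sel in uy | z∈xy
... | false | false | inj₁ refl = used-false ux e∈
... | false | false | inj₂ refl = used-false uy e∈

greedy-⊇ : ∀ sel cs {e} → e ∈ sel → e ∈ greedy sel cs
greedy-⊇ sel []             e∈ = e∈
greedy-⊇ sel ((x , y) ∷ cs) e∈ with used x sel ∨ used y sel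
... | true  = greedy-⊇ sel cs e∈
... | false = greedy-⊇ ((x , y) ∷ sel) cs (there e∈)

greedy-⊆ : ∀ sel cs {e} → e ∈ greedy sel cs → e ∈ sel ⊎ e ∈ cs
greedy-⊆ sel []             e∈ = inj₁ e∈
greedy-⊆ sel ((x , y) ∷ cs) e∈ with used x sel ∨ used y sel
... | true  = Sum.map₂ there (greedy-⊆ sel cs e∈)
... | false with greedy-⊆ ((x , y) ∷ sel) cs e∈
...   | inj₁ (here e≡xy)   = inj₂ (here e≡xy)
...   | inj₁ (there e∈sel) = inj₁ e∈sel
...   | inj₂ e∈cs          = inj₂ (there e∈cs)

NoSharedEndpoints : List (ℕ × ℕ) → Set
NoSharedEndpoints M = ∀ {e f} → e ∈ M → f ∈ M → SharesEndpoint e f → SameEdge e f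

greedy-disjoint : ∀ sel cs → NoSharedEndpoints sel → NoSharedEndpoints (greedy sel cs)
greedy-disjoint sel []             disj = disj
greedy-disjoint sel ((x , y) ∷ cs) disj with used x sel ∨ used y sel in unused
... | true  = greedy-disjoint sel cs disj
... | false = greedy-disjoint ((x , y) ∷ sel) cs disj′
  where
  disj′ : NoSharedEndpoints ((x , y) ∷ sel)
  disj′ (here refl) (here refl) _ = inj₁ (refl , refl)
  disj′ (here refl) (there f∈)  sh =
    let _ , z∈e , z∈f = shared-endpoint sh in ⊥-elim (pair-unused unused f∈ z∈e z∈f)
  disj′ (there e∈)  (here refl) sh =
    let _ , z∈e , z∈f = shared-endpoint sh in ⊥-elim (pair-unused unused e∈ z∈f z∈e)
  disj′ (there e∈)  (there f∈)  sh = disj e∈ f∈ sh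

greedy-blocked : (_≽_ : ℕ × ℕ → ℕ × ℕ → Set) → ∀ sel cs → AllPairs _≽_ cs →
  (∀ {f c} → f ∈ sel → c ∈ cs → f ≽ c) → ∀ {c} → c ∈ cs →
  c ∈ greedy sel cs ⊎ ∃ λ f → f ∈ greedy sel cs × f ≽ c × Touches c f
greedy-blocked _≽_ sel ((x , y) ∷ cs) (xy≽cs ∷ sorted) sel≽ c∈ with used x sel ∨ used y sel in used? | c∈
... | true  | here refl  = let f , f∈ , touch = pair-used used? in
                           inj₂ (f , greedy-⊇ sel cs f∈ , sel≽ f∈ (here refl) , touch)
... | true  | there c∈cs = greedy-blocked _≽_ sel cs sorted (λ f∈ c∈ → sel≽ f∈ (there c∈)) c∈cs
... | false | here refl  = inj₁ (greedy-⊇ ((x , y) ∷ sel) cs (here refl))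
... | false | there c∈cs = greedy-blocked _≽_ ((x , y) ∷ sel) cs sorted sel′≽ c∈cs
  where
  sel′≽ : ∀ {f c} → f ∈ (x , y) ∷ sel → c ∈ cs → f ≽ c
  sel′≽ (here refl) c∈ = All.lookup xy≽cs c∈
  sel′≽ (there f∈)  c∈ = sel≽ f∈ (there c∈)

weight : ℕ × ℕ → ℕ
weight (zero  , _) = 0
weight (suc x , y) = y / suc x

_⊒_ : ℕ × ℕ → ℕ × ℕ → Set
f ⊒ c = weight c ≤ weight f

weight-candidate : ∀ q {x} → 0 < x → weight (x , q * x) ≡ q
weight-candidate q {suc x} _ = m*n/n≡m q (suc x)

IsCandidate : ℕ → ℕ × ℕ → Set
IsCandidate N e = ∃ λ p → ∃ λ x → Prime p × 0 < x × p * x ≤ N × e ≡ (x , p * x)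

candidates⁻ : ∀ N {e} → e ∈ candidates N → IsCandidate N e
candidates⁻ N e∈ with find (∈-concatMap⁻ (Sdesc N) {xs = primesDesc N} e∈)
... | suc q , p∈ , e∈S with ∈-map⁻ (λ x → (x , suc q * x)) e∈S
...   | x , x∈ , refl with ∈-map⁻ suc x∈
...     | x' , x'∈ , refl =
  suc q , suc x' , proj₂ (∈-filter⁻ prime? {xs = downFrom (suc N)} p∈) , z<s , (begin
  suc q * suc x'        ≤⟨ *-monoʳ-≤ (suc q) (∈-downFrom⁻ x'∈) ⟩
  suc q * (N / suc q)   ≡⟨ *-comm (suc q) (N / suc q) ⟩
  N / suc q * suc q     ≤⟨ m/n*n≤m N (suc q) ⟩
  N                     ∎) , refl
  where open ≤-Reasoning

candidates⁺ : ∀ N {p x} → Prime p → 0 < x → p * x ≤ N → (x , p * x) ∈ candidates N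
candidates⁺ N {suc q} {suc x'} pp _ px≤N =
  ∈-concatMap⁺ (Sdesc N) {xs = primesDesc N} (Any.map (λ { refl → e∈S }) p∈)
  where
  p∈ : suc q ∈ primesDesc N
  p∈ = ∈-filter⁺ prime? (∈-downFrom⁺ (s≤s (≤-trans (m≤m*n (suc q) (suc x')) px≤N))) pp
  x'<N/p : x' < N / suc q
  x'<N/p = begin-strict
    x'                           <⟨ ≤-refl ⟩
    suc x'                       ≡⟨ m*n/n≡m (suc x') (suc q) ⟨
    suc x' * suc q / suc q       ≤⟨ /-monoˡ-≤ (suc q) (≤-reflexive (*-comm (suc x') (suc q))) ⟩
    suc q * suc x' / suc q       ≤⟨ /-monoˡ-≤ (suc q) px≤N ⟩
    N / suc q                    ∎
    where open ≤-Reasoning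
  e∈S : (suc x' , suc q * suc x') ∈ Sdesc N (suc q)
  e∈S = ∈-map⁺ (λ x → (x , suc q * x)) (∈-map⁺ suc (∈-downFrom⁺ x'<N/p))
candidates⁺ N {zero} pp with prime⇒>1 pp
... | ()

Sdesc-weight : ∀ N p → All.All (λ c → weight c ≡ p) (Sdesc N p)
Sdesc-weight N zero    = All.[]
Sdesc-weight N (suc q) =
  All.map⁺ (All.map⁺ (All.universal (λ x → weight-candidate (suc q) {suc x} z<s) _))

candidates-sorted : ∀ N → AllPairs _⊒_ (candidates N)
candidates-sorted N = AllPairs.concat⁺
  (All.map⁺ (All.universal (λ p → constant (Sdesc-weight N p)) (primesDesc N)))
  (AllPairs.map⁺ (AllPairs.map between
    (AllPairs.filter⁺ prime? (AllPairs.applyDownFrom⁺₁ id (suc N) (λ j<i _ → j<i)))))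
  where
  constant : ∀ {p cs} → All.All (λ c → weight c ≡ p) cs → AllPairs _⊒_ cs
  constant All.[]         = []
  constant (wc≡p All.∷ ws) = All.map (λ wd≡p → ≤-reflexive (trans wd≡p (sym wc≡p))) ws ∷ constant ws
  between : ∀ {p q} → q < p → All.All (λ c → All.All (c ⊒_) (Sdesc N q)) (Sdesc N p)
  between {p} {q} q<p = All.map (λ wc≡p → All.map (λ wd≡q → subst₂ _≤_ (sym wd≡q) (sym wc≡p) (<⇒≤ q<p))
    (Sdesc-weight N q)) (Sdesc-weight N p)

selected-candidate : ∀ N {e} → e ∈ selected N → IsCandidate N e
selected-candidate N e∈ with greedy-⊆ [] (candidates N) e∈
... | inj₂ e∈cs = candidates⁻ N e∈cs

selected-disjoint : ∀ N → NoSharedEndpoints (selected N)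
selected-disjoint N = greedy-disjoint [] (candidates N) (λ ())

selected-matching : ∀ N → IsMatching N (selected N)
selected-matching N = edge ∘ selected-candidate N , selected-disjoint N
  where
  edge : ∀ {e} → IsCandidate N e → Adj N (proj₁ e) (proj₂ e)
  edge (p , x , pp , 0<x , px≤N , refl) =
    (0<x , ≤-trans x≤px px≤N) , (≤-trans 0<x x≤px , px≤N) , inj₁ (p , pp , refl)
    where
    x≤px : x ≤ p * x
    x≤px = m≤n*m x p {{prime⇒nonZero pp}}

selected-step : ∀ N {e} → e ∈ selected N → Prime (weight e) × Step true (weight e) (proj₁ e) (proj₂ e)
selected-step N e∈ with selected-candidate N e∈
... | p , x , pp , 0<x , _ , refl rewrite weight-candidate p 0<x = pp , refl

candidate-blocked : ∀ N {q x} → Prime q → 0 < x → q * x ≤ N →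
  (x , q * x) ∈ selected N ⊎ ∃ λ f → f ∈ selected N × q ≤ weight f × Touches (x , q * x) f
candidate-blocked N {q} pq 0<x qx≤N =
  Sum.map₂ (λ (f , f∈ , w≤wf , touch) →
              f , f∈ , subst (_≤ weight f) (weight-candidate q 0<x) w≤wf , touch)
    (greedy-blocked _⊒_ [] (candidates N) (candidates-sorted N) (λ ()) (candidates⁺ N pq 0<x qx≤N))

unselected-edge-blocked : ∀ N {b q x y} → Prime q → Vertex N x → Vertex N y → Step b q x y →
  ¬ InM (selected N) x y → ∃ λ f → f ∈ selected N × q ≤ weight f × Touches (x , y) f
unselected-edge-blocked N {true} pq (0<x , _) (_ , y≤N) refl ¬xy with candidate-blocked N pq 0<x y≤N
... | inj₁ xy∈   = ⊥-elim (¬xy (inj₁ xy∈))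
... | inj₂ block = block
unselected-edge-blocked N {false} pq (_ , x≤N) (0<y , _) refl ¬xy with candidate-blocked N pq 0<y x≤N
... | inj₁ yx∈ = ⊥-elim (¬xy (inj₂ yx∈))
... | inj₂ (f , f∈ , q≤wf , z , z∈yx , z∈f) = f , f∈ , q≤wf , z , Sum.swap z∈yx , z∈f

step-flip : ∀ b {q x y} → Step b q x y → Step (not b) q y x
step-flip true  s = s
step-flip false s = s

sameEdge-step : ∀ {q a b x y} → Step true q a b → SameEdge (a , b) (x , y) → ∃ λ c → Step c q x y
sameEdge-step s (inj₁ (refl , refl)) = true , s
sameEdge-step s (inj₂ (refl , refl)) = false , s

touching-selected-step : ∀ N {x y f z} → InM (selected N) x y → f ∈ selected N →
  Endpoint z f → Endpoint z (x , y) → ∃ λ c → Step c (weight f) x y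
touching-selected-step N {f = _ , _} (inj₁ xy∈) f∈ z∈f z∈xy =
  sameEdge-step (proj₂ (selected-step N f∈)) (selected-disjoint N f∈ xy∈ (endpoints-shared z∈f z∈xy))
touching-selected-step N {f = _ , _} (inj₂ yx∈) f∈ z∈f z∈xy
  with sameEdge-step (proj₂ (selected-step N f∈))
         (selected-disjoint N f∈ yx∈ (endpoints-shared z∈f (Sum.swap z∈xy)))
... | c , s = not c , step-flip c s

-- Flat alternating cycles

module FlatAlternatingCycle
  (N k : ℕ) (v : ℕ → ℕ) (3≤k : 3 ≤ k) (periodic : Periodic k v)
  (injective : ∀ i j → i < k → j < k → v i ≡ v j → i ≡ j)
  (adjacent : ∀ i → Adj N (v i) (v (suc i)))
  (n : ℕ) (level : ∀ i → Level n (v i))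
  (alternating : Alternates (λ i → InM (selected N) (v i) (v (suc i))))
  where

  instance
    k≢0 : NonZero k
    k≢0 = >-nonZero (<-≤-trans z<s 3≤k)

  Matched : ℕ → Set
  Matched i = InM (selected N) (v i) (v (suc i))

  vertex : ∀ i → Vertex N (v i)
  vertex i = proj₁ (adjacent i)

  u : ℕ → Bool
  u i = lower (level i)

  edge : ∀ i → ∃ λ q → Prime q × Step (u i) q (v i) (v (suc i)) × u (suc i) ≡ not (u i)
  edge i = flat-step (level i) (level (suc i)) (proj₂ (proj₂ (adjacent i)))

  r : ℕ → ℕ
  r i = proj₁ (edge i)

  r-prime : ∀ i → Prime (r i)
  r-prime i = proj₁ (proj₂ (edge i))

  step : ∀ i → Step (u i) (r i) (v i) (v (suc i))
  step i = proj₁ (proj₂ (proj₂ (edge i)))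

  u-flips : ∀ i → u (suc i) ≡ not (u i)
  u-flips i = proj₂ (proj₂ (proj₂ (edge i)))

  r-periodic : Periodic k r
  r-periodic i =
    step-factor-unique (proj₁ (vertex i)) (prime⇒>1 (r-prime (i + k))) (prime⇒>1 (r-prime i))
    (subst₂ (Step (u (i + k)) (r (i + k))) (periodic i) (periodic (suc i)) (step (i + k))) (step i)

  labels-change : ∀ i → r i ≢ r (suc i)
  labels-change i ri≡rsi =
    periodic-distinct periodic injective i z<s 2<k (trans (cong v (+-comm i 2)) back)
    where
    2<k : 2 < k
    2<k = 3≤k
    back : v (suc (suc i)) ≡ v i
    back = step-back {{prime⇒nonZero (r-prime i)}} (step i)
      (subst₂ (λ b q → Step b q _ _) (u-flips i) (sym ri≡rsi) (step (suc i)))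

  matched-weight : ∀ {e f z} → Matched e → f ∈ selected N → Endpoint z f → Endpoint z (v e , v (suc e)) →
    weight f ≡ r e
  matched-weight {e} me f∈ z∈f z∈e with touching-selected-step N me f∈ z∈f z∈e
  ... | _ , s = step-factor-unique (proj₁ (vertex e)) (prime⇒>1 (proj₁ (selected-step N f∈)))
                  (prime⇒>1 (r-prime e)) s (step e)

  prior : ℕ → ℕ
  prior i = i + pred k

  suc-prior : ∀ i → suc (prior i) ≡ i + k
  suc-prior i = trans (sym (+-suc i (pred k))) (cong (i +_) (suc-pred k))

  v-after-prior : ∀ i → v (suc (prior i)) ≡ v i
  v-after-prior i = trans (cong v (suc-prior i)) (periodic i)

  r-after-prior : ∀ i → r (suc (prior i)) ≡ r i
  r-after-prior i = trans (cong r (suc-prior i)) (r-periodic i)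

  unmatched-dominated : ∀ i → ¬ Matched i → ∃ λ j → r i < r j
  unmatched-dominated i ¬mi
    with unselected-edge-blocked N (r-prime i) (vertex i) (vertex (suc i)) (step i) ¬mi
  ... | f , f∈ , ri≤wf , z , inj₂ refl , z∈f =
    suc i ,
    ≤∧≢⇒< (subst (r i ≤_) (matched-weight next-matched f∈ z∈f (inj₁ refl)) ri≤wf) (labels-change i)
    where
    next-matched : Matched (suc i)
    next-matched = [ (λ mi → ⊥-elim (¬mi mi)) , id ]′ (proj₁ (alternating i))
  ... | f , f∈ , ri≤wf , z , inj₁ refl , z∈f =
    prior i ,
    ≤∧≢⇒< (subst (r i ≤_) (matched-weight prior-matched f∈ z∈f (inj₂ (sym (v-after-prior i)))) ri≤wf)
          (λ ri≡rp → labels-change (prior i) (trans (sym ri≡rp) (sym (r-after-prior i))))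
    where
    prior-matched : Matched (prior i)
    prior-matched =
      [ id , ⊥-elim ∘ ¬mi ∘ subst₂ (InM (selected N)) (v-after-prior i) (v-after-prior (suc i)) ]′
        (proj₁ (alternating (prior i)))

  impossible : ⊥
  impossible = closed-walk-balanced (r-prime j) step (proj₁ (vertex 0)) (periodic 0) j<k ∣-refl one-way
    where
    maximal : ∃ λ j → j < k × ∀ i → r i ≤ r j
    maximal = periodic-max r-periodic
    j : ℕ
    j = proj₁ maximal
    j<k : j < k
    j<k = proj₁ (proj₂ maximal)
    unmatched-below : ∀ i → ¬ Matched i → r i < r j
    unmatched-below i ¬mi = let i' , ri<ri' = unmatched-dominated i ¬mi in
      <-≤-trans ri<ri' (proj₂ (proj₂ maximal) i')
    j-matched : Matched j
    j-matched with proj₁ (alternating j)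
    ... | inj₁ mj  = mj
    ... | inj₂ msj = ⊥-elim (<-irrefl refl (unmatched-below j (λ mj → proj₂ (alternating j) (mj , msj))))
    matched⇔same-direction : ∀ i → Matched i ⇔ (u i ≡ u j)
    matched⇔same-direction =
      alternates-agree alternating (alternates-bool u-flips (u j)) j (mk⇔ (λ _ → refl) (λ _ → j-matched))
    one-way : ∀ s → s < k → u s ≢ u j → r j ∤ r s
    one-way s _ us≢uj = >⇒∤ {{prime⇒nonZero (r-prime s)}}
      (unmatched-below s (us≢uj ∘ Equivalence.to (matched⇔same-direction s)))

theorem3 : (N : ℕ) → 1 ≤ N →
    IsMatching N (selected N) ×
    (∀ k v → ¬ (IsCycle N k v × Alternating (selected N) v × Flat v))
theorem3 N _ = selected-matching N ,
  λ k v ((3≤k , periodic , injective , adjacent) , alternating , n , level) →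
    FlatAlternatingCycle.impossible N k v 3≤k periodic injective adjacent n level alternating
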